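{- Let $G$ be the circle graph of length $r\ge1$ (a single cycle on $r$ nodes, each of degree $2$), let $\mathbf{B}$ be its non-backtracking matrix, let $k$ be a node of $G$, and let $\lambda$ satisfy $\lambda^r=1$. Define $V=\{\mathbf{v}:\mathbf{B}\mathbf{v}=\lambda\mathbf{v}\}$ and $W(k)=\{\mathbf{v}:\mathbf{B}\mathbf{v}=\lambda\mathbf{v}\text{ and }\sum_{e:\,t(e)=k}\mathbf{v}_e=0\}$. Then $\dim V=2$ and $\dim W(k)=1$.
   Context: For $r=1$ the circle graph is one node with a loop, for $r=2$ two nodes joined by two parallel edges. Each edge with endpoints $u,v$ (possibly $u=v$) yields two oriented edges; for an oriented edge $e$ write $s(e),t(e)$ for its source and target and $\bar e$ for the opposite orientation of the same edge. $\mathbf{B}$ is indexed by oriented edges with $\mathbf{B}_{f,e}=1$ if $t(e)=s(f)$ and $f\neq\bar e$, and $0$ otherwise. -}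

module Defs where

open import Level using (Level; _⊔_; Lift)
open import Algebra.Bundles using (CommutativeRing)
open import Data.Nat as ℕ using (ℕ; zero; suc)
open import Data.Nat.DivMod using (_mod_)
open import Data.Fin as Fin using (Fin; zero; suc)
open import Data.Bool using (Bool; true; false; not)
open import Data.Product using (Σ; _×_; _,_; ∃)
open import Relation.Nullary using (¬_; Dec; yes; no)
open import Relation.Nullary.Decidable using (_×-dec_; ¬?)
open import Relation.Binary.PropositionalEquality using (_≡_)
import Data.Fin.Properties as FinP
import Data.Bool.Properties as BoolP
import Data.Product.Properties as ProdP

record Field (c ℓ : Level) : Set (Level.suc (c ⊔ ℓ)) where
  field
    commutativeRing : CommutativeRing c ℓ
  open CommutativeRing commutativeRing public
  field
    0≉1     : ¬ (0# ≈ 1#)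
    inverse : ∀ x → ¬ (x ≈ 0#) → Σ Carrier λ y → x * y ≈ 1#

-- Finite multigraphs (loops and parallel edges allowed).
-- Edge e joins the nodes  end₀ e  and  end₁ e  (possibly equal).

record Multigraph : Set where
  field
    nNodes : ℕ
    nEdges : ℕ
    end₀   : Fin nEdges → Fin nNodes
    end₁   : Fin nEdges → Fin nNodes

module _ (G : Multigraph) where
  open Multigraph G

  OEdge : Set
  OEdge = Fin nEdges × Bool

  src : OEdge → Fin nNodes
  src (e , false) = end₀ e
  src (e , true)  = end₁ e

  tgt : OEdge → Fin nNodes
  tgt (e , false) = end₁ e
  tgt (e , true)  = end₀ e

  rev : OEdge → OEdge
  rev (e , b) = (e , not b)

  _≟ₒ_ : (x y : OEdge) → Dec (x ≡ y)
  _≟ₒ_ = ProdP.≡-dec FinP._≟_ BoolP._≟_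

  nbAdj? : (f e : OEdge) → Dec ((tgt e ≡ src f) × ¬ (f ≡ rev e))
  nbAdj? f e = (tgt e FinP.≟ src f) ×-dec ¬? (f ≟ₒ rev e)

-- The circle graph of length r: nodes 0,…,r-1, edge i joins node i and
-- node i+1 (mod r).  For r = 1 this is one node with a loop, for r = 2
-- two nodes joined by two parallel edges.

next : ∀ {r} → Fin r → Fin r
next {suc r} i = suc (Fin.toℕ i) mod suc r

circleGraph : ℕ → Multigraph
circleGraph r = record
  { nNodes = r ; nEdges = r ; end₀ = λ i → i ; end₁ = next }

module LinAlg {c ℓ : Level} (F : Field c ℓ) where
  open Field F hiding (zero)

  ∑ : ∀ {n} → (Fin n → Carrier) → Carrier
  ∑ {zero}  f = 0#
  ∑ {suc n} f = f zero + ∑ (λ i → f (suc i))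

  _^ᶠ_ : Carrier → ℕ → Carrier
  x ^ᶠ zero  = 1#
  x ^ᶠ suc n = x * (x ^ᶠ n)

  module OnGraph (G : Multigraph) where
    open Multigraph G

    Vect : Set c
    Vect = OEdge G → Carrier

    _≈ᵥ_ : Vect → Vect → Set ℓ
    u ≈ᵥ v = ∀ e → u e ≈ v e

    0ᵥ : Vect
    0ᵥ _ = 0#

    ∑ₒ : (OEdge G → Carrier) → Carrier
    ∑ₒ f = ∑ (λ e → f (e , false) + f (e , true))

    B : OEdge G → OEdge G → Carrier
    B f e with nbAdj? G f e
    ... | yes _ = 1#
    ... | no  _ = 0#

    Bmul : Vect → Vect
    Bmul v f = ∑ₒ (λ e → B f e * v e)

    lincomb : ∀ {d} → (Fin d → Carrier) → (Fin d → Vect) → Vect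
    lincomb a b e = ∑ (λ i → a i * b i e)

    HasDim : (Vect → Set (c ⊔ ℓ)) → ℕ → Set (c ⊔ ℓ)
    HasDim P d = Σ (Fin d → Vect) λ b →
        (∀ i → P (b i))
      × (∀ a → lincomb a b ≈ᵥ 0ᵥ → ∀ i → a i ≈ 0#)
      × (∀ v → P v → Σ (Fin d → Carrier) λ a → v ≈ᵥ lincomb a b)

  module Circle (r : ℕ) (λ₀ : Carrier) where
    G = circleGraph r
    open OnGraph G

    V : Vect → Set (c ⊔ ℓ)
    V v = Lift (c ⊔ ℓ) (Bmul v ≈ᵥ (λ e → λ₀ * v e))

    W : Fin r → Vect → Set (c ⊔ ℓ)
    W k v = Lift (c ⊔ ℓ) ((Bmul v ≈ᵥ (λ e → λ₀ * v e))
              × ∑ₒ (λ e → into e * v e) ≈ 0#)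
      where
      into : OEdge G → Carrier
      into e with tgt G e FinP.≟ k
      ... | yes _ = 1#
      ... | no  _ = 0#

-- On the circle every oriented edge e has exactly one non-backtracking predecessor p(e),
-- the previous edge in the same direction of travel, so B v = λ v says v(p(e)) = λ v(e):
-- along each of the two directions of travel v is a geometric sequence with ratio
-- λ⁻¹ = λ^(r-1). Since λ^r = 1 both sequences close up around the cycle, so V is
-- parametrised by two free starting values. The two oriented edges entering k are
-- k-1 → k and k+1 → k, so on V the sum defining W(k) becomes λ v(k → k+1) + v(k+1 → k),
-- a non-zero linear form in those two parameters, and W(k) is a line.

module Submission where

open import Defs
open import Level using (Level; Lift; lift; _⊔_)
open import Data.Nat using (ℕ; zero; suc; _≤_; s≤s)
open import Data.Nat.DivMod using (_%_; n%n≡0; m<n⇒m%n≡m)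
open import Data.Fin using (Fin; zero; suc; toℕ; fromℕ; inject₁)
open import Data.Fin.Properties
  using (_≟_; toℕ-injective; toℕ-fromℕ<; toℕ-fromℕ; toℕ-inject₁; toℕ<n; punchInᵢ≢i)
open import Data.Fin.Induction using (<-weakInduction)
open import Data.Bool using (false; true)
open import Data.Product using (Σ; _×_; _,_; proj₁; proj₂)
open import Data.Empty using (⊥-elim)
open import Data.Vec.Functional using (_∷_; []; removeAt)
open import Function using (_∘_)
open import Relation.Nullary using (¬_; yes; no)
open import Relation.Binary.PropositionalEquality as ≡ using (_≡_; _≢_)

module _ {m : ℕ} where
  open ≡.≡-Reasoning

  toℕ-next : (i : Fin (suc m)) → toℕ (next i) ≡ suc (toℕ i) % suc m
  toℕ-next i = toℕ-fromℕ< _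

  next-fromℕ : next (fromℕ m) ≡ zero
  next-fromℕ = toℕ-injective (begin
    toℕ (next (fromℕ m))        ≡⟨ toℕ-next (fromℕ m) ⟩
    suc (toℕ (fromℕ m)) % suc m ≡⟨ ≡.cong (λ t → suc t % suc m) (toℕ-fromℕ m) ⟩
    suc m % suc m               ≡⟨ n%n≡0 (suc m) ⟩
    0                           ∎)

  next-inject₁ : (j : Fin m) → next (inject₁ j) ≡ suc j
  next-inject₁ j = toℕ-injective (begin
    toℕ (next (inject₁ j))        ≡⟨ toℕ-next (inject₁ j) ⟩
    suc (toℕ (inject₁ j)) % suc m ≡⟨ ≡.cong (λ t → suc t % suc m) (toℕ-inject₁ j) ⟩
    suc (toℕ j) % suc m           ≡⟨ m<n⇒m%n≡m (s≤s (toℕ<n j)) ⟩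
    suc (toℕ j)                   ∎)

data LastOrInject₁ : {m : ℕ} → Fin (suc m) → Set where
  last  : ∀ {m} → LastOrInject₁ (fromℕ m)
  inner : ∀ {m} (j : Fin m) → LastOrInject₁ (inject₁ j)

lastOrInject₁ : ∀ {m} (i : Fin (suc m)) → LastOrInject₁ i
lastOrInject₁ {zero}  zero    = last
lastOrInject₁ {suc m} zero    = inner zero
lastOrInject₁ {suc m} (suc i) with lastOrInject₁ i
... | last    = last
... | inner j = inner (suc j)

module _ {m : ℕ} where

  prev : Fin (suc m) → Fin (suc m)
  prev zero    = fromℕ m
  prev (suc j) = inject₁ j

  next-prev : ∀ i → next (prev i) ≡ i
  next-prev zero    = next-fromℕ
  next-prev (suc j) = next-inject₁ j

  prev-next : ∀ i → prev (next i) ≡ i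
  prev-next i with lastOrInject₁ i
  ... | last    = ≡.cong prev next-fromℕ
  ... | inner j = ≡.cong prev (next-inject₁ j)

  next≡⇒≡prev : ∀ {i j} → next j ≡ i → j ≡ prev i
  next≡⇒≡prev {j = j} next-j≡i = ≡.trans (≡.sym (prev-next j)) (≡.cong prev next-j≡i)

  next-injective : ∀ {i j} → next i ≡ next j → i ≡ j
  next-injective {j = j} next-i≡next-j = ≡.trans (next≡⇒≡prev next-i≡next-j) (prev-next j)

module _ {c ℓ : Level} (F : Field c ℓ) where
  open Field F hiding (zero)
  open LinAlg F
  open import Algebra.Properties.Semiring.Sum semiring
    using (sum; sum-remove; sum-cong-≋; sum-replicate-zero; ∑-distrib-+)
  open import Algebra.Properties.Group +-group using (inverseʳ-unique)
  open import Algebra.Properties.Ring ring using (-‿distribˡ-*; -‿distribʳ-*)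
  open import Relation.Binary.Reasoning.Setoid setoid
  open import Algebra.Properties.CommutativeSemigroup *-commutativeSemigroup
    using (interchange; x∙yz≈y∙xz; xy∙z≈x∙zy; xy∙z≈xz∙y; xy∙z≈y∙xz)

  x+y*0≈x : ∀ x y → x + y * 0# ≈ x
  x+y*0≈x x y = trans (+-congˡ (zeroʳ y)) (+-identityʳ x)

  x*0+y≈y : ∀ x y → x * 0# + y ≈ y
  x*0+y≈y x y = trans (+-congʳ (zeroʳ x)) (+-identityˡ y)

  *-cancel-inverse : ∀ {a b x y} → a * b ≈ 1# → x ≈ b * y → a * x ≈ y
  *-cancel-inverse {a} {b} {x} {y} ab≈1 x≈by = begin
    a * x       ≈⟨ *-congˡ x≈by ⟩
    a * (b * y) ≈⟨ *-assoc a b y ⟨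
    a * b * y   ≈⟨ *-congʳ ab≈1 ⟩
    1# * y      ≈⟨ *-identityˡ y ⟩
    y           ∎

  ^ᶠ-inverse : ∀ {a b} → a * b ≈ 1# → ∀ n → a ^ᶠ n * b ^ᶠ n ≈ 1#
  ^ᶠ-inverse ab≈1 zero    = *-identityˡ 1#
  ^ᶠ-inverse {a} {b} ab≈1 (suc n) = begin
    a * a ^ᶠ n * (b * b ^ᶠ n)      ≈⟨ interchange a (a ^ᶠ n) b (b ^ᶠ n) ⟩
    a * b * (a ^ᶠ n * b ^ᶠ n)      ≈⟨ *-cong ab≈1 (^ᶠ-inverse ab≈1 n) ⟩
    1# * 1#                        ≈⟨ *-identityˡ 1# ⟩
    1#                             ∎

  -- Not definitional for a variable length: the two recursions get stuck differently.
  ∑≡sum : ∀ {n} (f : Fin n → Carrier) → ∑ f ≡ sum f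
  ∑≡sum {zero}  f = ≡.refl
  ∑≡sum {suc n} f = ≡.cong (f zero +_) (∑≡sum (f ∘ suc))

  sum-zero : ∀ {n} (f : Fin n → Carrier) → (∀ i → f i ≈ 0#) → sum f ≈ 0#
  sum-zero {n} f f≈0 = trans (sum-cong-≋ f≈0) (sum-replicate-zero n)

  ∑-zero : ∀ {n} (f : Fin n → Carrier) → (∀ i → f i ≈ 0#) → ∑ f ≈ 0#
  ∑-zero f f≈0 rewrite ∑≡sum f = sum-zero f f≈0

  ∑-single : ∀ {n} (f : Fin n → Carrier) i → (∀ j → j ≢ i → f j ≈ 0#) → ∑ f ≈ f i
  ∑-single {suc n} f i f≈0 = begin
    ∑ f                      ≡⟨ ∑≡sum f ⟩
    sum f                    ≈⟨ sum-remove {i = i} f ⟩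
    f i + sum (removeAt f i) ≈⟨ +-congˡ (sum-zero _ (λ j → f≈0 _ (punchInᵢ≢i i j))) ⟩
    f i + 0#                 ≈⟨ +-identityʳ (f i) ⟩
    f i                      ∎

  ∑-+ : ∀ {n} (f g : Fin n → Carrier) → ∑ (λ i → f i + g i) ≈ ∑ f + ∑ g
  ∑-+ f g rewrite ∑≡sum (λ i → f i + g i) | ∑≡sum f | ∑≡sum g = ∑-distrib-+ f g

  module _ (G : Multigraph) where
    open OnGraph G

    ∑ₒ-split : (g : OEdge G → Carrier) → ∑ₒ g ≈ ∑ (λ j → g (j , false)) + ∑ (λ j → g (j , true))
    ∑ₒ-split g = ∑-+ (λ j → g (j , false)) (λ j → g (j , true))

    ∑ₒ-single : (g : OEdge G → Carrier) (e₀ : OEdge G) → (∀ e → e ≢ e₀ → g e ≈ 0#) →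
                ∑ₒ g ≈ g e₀
    ∑ₒ-single g (i , false) g≈0 = begin
      ∑ₒ g                                              ≈⟨ ∑ₒ-split g ⟩
      ∑ (λ j → g (j , false)) + ∑ (λ j → g (j , true)) ≈⟨ +-cong
        (∑-single (λ j → g (j , false)) i (λ j j≢i → g≈0 _ (j≢i ∘ ≡.cong proj₁)))
        (∑-zero (λ j → g (j , true)) (λ j → g≈0 _ λ ())) ⟩
      g (i , false) + 0#                                ≈⟨ +-identityʳ _ ⟩
      g (i , false)                                     ∎
    ∑ₒ-single g (i , true) g≈0 = begin
      ∑ₒ g                                              ≈⟨ ∑ₒ-split g ⟩
      ∑ (λ j → g (j , false)) + ∑ (λ j → g (j , true)) ≈⟨ +-cong
        (∑-zero (λ j → g (j , false)) (λ j → g≈0 _ λ ()))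
        (∑-single (λ j → g (j , true)) i (λ j j≢i → g≈0 _ (j≢i ∘ ≡.cong proj₁))) ⟩
      0# + g (i , true)                                 ≈⟨ +-identityˡ _ ⟩
      g (i , true)                                      ∎

    B-nonBacktracking : ∀ {f e} → tgt G e ≡ src G f → f ≢ rev G e → B f e ≈ 1#
    B-nonBacktracking {f} {e} e→f f≢ē with nbAdj? G f e
    ... | yes _      = refl
    ... | no ¬e→f→ = ⊥-elim (¬e→f→ (e→f , f≢ē))

    B-backtrackingOrDisjoint : ∀ {f e} → ¬ (tgt G e ≡ src G f × f ≢ rev G e) → B f e ≈ 0#
    B-backtrackingOrDisjoint {f} {e} ¬e→f→ with nbAdj? G f e
    ... | yes e→f→ = ⊥-elim (¬e→f→ e→f→)
    ... | no _      = refl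

    Bmul-uniquePredecessor :
      (pred : OEdge G → OEdge G) →
      (∀ f → tgt G (pred f) ≡ src G f × f ≢ rev G (pred f)) →
      (∀ f e → tgt G e ≡ src G f → f ≢ rev G e → e ≡ pred f) →
      ∀ v f → Bmul v f ≈ v (pred f)
    Bmul-uniquePredecessor pred pred-adjacent pred-unique v f = begin
      Bmul v f                  ≈⟨ ∑ₒ-single _ (pred f) other ⟩
      B f (pred f) * v (pred f) ≈⟨ *-congʳ (B-nonBacktracking e→f f≢ē) ⟩
      1# * v (pred f)           ≈⟨ *-identityˡ _ ⟩
      v (pred f)                ∎
      where
      e→f = proj₁ (pred-adjacent f)
      f≢ē = proj₂ (pred-adjacent f)
      other : ∀ e → e ≢ pred f → B f e * v e ≈ 0#
      other e e≢pred = trans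
        (*-congʳ (B-backtrackingOrDisjoint λ (e→f , f≢ē) → e≢pred (pred-unique f e e→f f≢ē)))
        (zeroˡ (v e))

  Geometric : ∀ {m} → Carrier → (Fin (suc m) → Carrier) → Set ℓ
  Geometric a u = ∀ i → u (next i) ≈ a * u i

  geometric-closedForm : ∀ {m a} {u : Fin (suc m) → Carrier} → Geometric a u →
                         ∀ i → u i ≈ a ^ᶠ toℕ i * u zero
  geometric-closedForm {a = a} {u} geo =
    <-weakInduction (λ i → u i ≈ a ^ᶠ toℕ i * u zero) (sym (*-identityˡ (u zero))) step
    where
    step : ∀ j → u (inject₁ j) ≈ a ^ᶠ toℕ (inject₁ j) * u zero →
                 u (suc j) ≈ a ^ᶠ toℕ (suc j) * u zero
    step j ih = begin
      u (suc j)                           ≡⟨ ≡.cong u (next-inject₁ j) ⟨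
      u (next (inject₁ j))                ≈⟨ geo (inject₁ j) ⟩
      a * u (inject₁ j)                   ≈⟨ *-congˡ ih ⟩
      a * (a ^ᶠ toℕ (inject₁ j) * u zero) ≡⟨ ≡.cong (λ t → a * (a ^ᶠ t * u zero)) (toℕ-inject₁ j) ⟩
      a * (a ^ᶠ toℕ j * u zero)           ≈⟨ *-assoc a _ _ ⟨
      a ^ᶠ suc (toℕ j) * u zero           ∎

  powers-geometric : ∀ {m a} → a ^ᶠ suc m ≈ 1# → Geometric a (λ (i : Fin (suc m)) → a ^ᶠ toℕ i)
  powers-geometric {m} aʳ≈1 i with lastOrInject₁ i
  ... | last    rewrite next-fromℕ {m} | toℕ-fromℕ m = sym aʳ≈1
  ... | inner j rewrite next-inject₁ j | toℕ-inject₁ j = refl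

  zero-geometric : ∀ {m a} → Geometric a (λ (_ : Fin (suc m)) → 0#)
  zero-geometric {a = a} _ = sym (zeroʳ a)

  geometric-lincomb : ∀ {m a} {u w : Fin (suc m) → Carrier} → Geometric a u → Geometric a w →
                      ∀ x y → Geometric a (λ i → x * u i + y * w i)
  geometric-lincomb {a = a} {u} {w} geo-u geo-w x y i = begin
    x * u (next i) + y * w (next i) ≈⟨ +-cong (*-congˡ (geo-u i)) (*-congˡ (geo-w i)) ⟩
    x * (a * u i) + y * (a * w i)   ≈⟨ +-cong (x∙yz≈y∙xz x a (u i)) (x∙yz≈y∙xz y a (w i)) ⟩
    a * (x * u i) + a * (y * w i)   ≈⟨ distribˡ a _ _ ⟨
    a * (x * u i + y * w i)         ∎

  -- Defs introduces the weights  [t(e) = k]  of W(k) only in a where-clause; we recover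
  -- them by unification against the unfolded definition of W, which only succeeds while
  -- r is a variable (for r = suc m the sum unfolds and the weights no longer match a pattern).
  inflowWeight : ∀ {r} → Carrier → Fin r → OnGraph.Vect (circleGraph r) → OEdge (circleGraph r) → Carrier
  inflowWeight {r} λ₀ k v = weightOf ≡.refl
    where
    open OnGraph (circleGraph r)
    weightOf : ∀ {A : Set ℓ} {ι₀ ι₁ : Fin r → Carrier} →
               Circle.W r λ₀ k v ≡ Lift (c ⊔ ℓ) (A × ∑ (λ i → ι₀ i * v (i , false) + ι₁ i * v (i , true)) ≈ 0#) →
               OEdge (circleGraph r) → Carrier
    weightOf {ι₀ = ι₀} _ (i , false) = ι₀ i
    weightOf {ι₁ = ι₁} _ (i , true)  = ι₁ i

  module CircleEigenvectors (m : ℕ) (λ₀ : Carrier) (λʳ≈1 : λ₀ ^ᶠ suc m ≈ 1#) where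
    open Circle (suc m) λ₀
    open OnGraph G

    -- λ⁻¹
    μ : Carrier
    μ = λ₀ ^ᶠ m

    λμ≈1 : λ₀ * μ ≈ 1#
    λμ≈1 = λʳ≈1

    μλ≈1 : μ * λ₀ ≈ 1#
    μλ≈1 = trans (*-comm μ λ₀) λμ≈1

    μʳ≈1 : μ ^ᶠ suc m ≈ 1#
    μʳ≈1 = begin
      μ ^ᶠ suc m                  ≈⟨ *-identityˡ _ ⟨
      1# * μ ^ᶠ suc m             ≈⟨ *-congʳ λʳ≈1 ⟨
      λ₀ ^ᶠ suc m * μ ^ᶠ suc m    ≈⟨ ^ᶠ-inverse λμ≈1 (suc m) ⟩
      1#                          ∎

    nbPredecessor : OEdge G → OEdge G
    nbPredecessor (i , false) = (prev i , false)
    nbPredecessor (i , true)  = (next i , true)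

    nbPredecessor-adjacent : ∀ f → tgt G (nbPredecessor f) ≡ src G f × f ≢ rev G (nbPredecessor f)
    nbPredecessor-adjacent (i , false) = next-prev i , λ ()
    nbPredecessor-adjacent (i , true)  = ≡.refl , λ ()

    nbPredecessor-unique : ∀ f e → tgt G e ≡ src G f → f ≢ rev G e → e ≡ nbPredecessor f
    nbPredecessor-unique (i , false) (j , false) next-j≡i _ = ≡.cong (_, false) (next≡⇒≡prev next-j≡i)
    nbPredecessor-unique (i , false) (j , true)  j≡i f≢ē     = ⊥-elim (f≢ē (≡.cong (_, false) (≡.sym j≡i)))
    nbPredecessor-unique (i , true)  (j , false) next-j≡next-i f≢ē =
      ⊥-elim (f≢ē (≡.cong (_, true) (≡.sym (next-injective next-j≡next-i))))
    nbPredecessor-unique (i , true)  (j , true)  j≡next-i _ = ≡.cong (_, true) j≡next-i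

    Bmul-nbPredecessor : ∀ v f → Bmul v f ≈ v (nbPredecessor f)
    Bmul-nbPredecessor = Bmul-uniquePredecessor G nbPredecessor nbPredecessor-adjacent nbPredecessor-unique

    IsEigenvector : Vect → Set ℓ
    IsEigenvector v = Bmul v ≈ᵥ (λ e → λ₀ * v e)

    forward backward : Vect → Fin (suc m) → Carrier
    forward  v i = v (i , false)
    backward v i = v (i , true)

    eigenvector⇒geometric : ∀ {v} → IsEigenvector v → Geometric μ (forward v) × Geometric λ₀ (backward v)
    eigenvector⇒geometric {v} eig = forward-geometric , backward-geometric
      where
      forward-geometric : Geometric μ (forward v)
      forward-geometric i = sym (*-cancel-inverse μλ≈1 (begin
        v (i , false)             ≡⟨ ≡.cong (λ j → v (j , false)) (prev-next i) ⟨
        v (prev (next i) , false) ≈⟨ Bmul-nbPredecessor v (next i , false) ⟨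
        Bmul v (next i , false)   ≈⟨ eig (next i , false) ⟩
        λ₀ * v (next i , false)   ∎))
      backward-geometric : Geometric λ₀ (backward v)
      backward-geometric i = trans (sym (Bmul-nbPredecessor v (i , true))) (eig (i , true))

    geometric⇒eigenvector : ∀ {v} → Geometric μ (forward v) → Geometric λ₀ (backward v) → IsEigenvector v
    geometric⇒eigenvector {v} forward-geometric _ (i , false) = begin
      Bmul v (i , false) ≈⟨ Bmul-nbPredecessor v (i , false) ⟩
      v (prev i , false) ≈⟨ *-cancel-inverse λμ≈1 (begin
        v (i , false)             ≡⟨ ≡.cong (λ j → v (j , false)) (next-prev i) ⟨
        v (next (prev i) , false) ≈⟨ forward-geometric (prev i) ⟩
        μ * v (prev i , false)    ∎) ⟨
      λ₀ * v (i , false) ∎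
    geometric⇒eigenvector {v} _ backward-geometric (i , true) =
      trans (Bmul-nbPredecessor v (i , true)) (backward-geometric i)

    forwardEigenvector backwardEigenvector : Vect
    forwardEigenvector (i , false)  = μ ^ᶠ toℕ i
    forwardEigenvector (i , true)   = 0#
    backwardEigenvector (i , false) = 0#
    backwardEigenvector (i , true)  = λ₀ ^ᶠ toℕ i

    eigenvector : Carrier → Carrier → Vect
    eigenvector x y e = x * forwardEigenvector e + y * backwardEigenvector e

    eigenvector-isEigenvector : ∀ x y → IsEigenvector (eigenvector x y)
    eigenvector-isEigenvector x y = geometric⇒eigenvector
      (geometric-lincomb (powers-geometric μʳ≈1) zero-geometric x y)
      (geometric-lincomb zero-geometric (powers-geometric λʳ≈1) x y)

    eigenvector-unique : ∀ {v} → IsEigenvector v → v ≈ᵥ eigenvector (v (zero , false)) (v (zero , true))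
    eigenvector-unique {v} eig (i , false) = begin
      v (i , false)                  ≈⟨ geometric-closedForm (proj₁ (eigenvector⇒geometric eig)) i ⟩
      μ ^ᶠ toℕ i * v (zero , false)  ≈⟨ *-comm _ _ ⟩
      v (zero , false) * μ ^ᶠ toℕ i  ≈⟨ x+y*0≈x _ _ ⟨
      eigenvector (v (zero , false)) (v (zero , true)) (i , false) ∎
    eigenvector-unique {v} eig (i , true) = begin
      v (i , true)                   ≈⟨ geometric-closedForm (proj₂ (eigenvector⇒geometric eig)) i ⟩
      λ₀ ^ᶠ toℕ i * v (zero , true)  ≈⟨ *-comm _ _ ⟩
      v (zero , true) * λ₀ ^ᶠ toℕ i  ≈⟨ x*0+y≈y _ _ ⟨
      eigenvector (v (zero , false)) (v (zero , true)) (i , true) ∎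

    eigenvector-injective : ∀ {x y} → eigenvector x y ≈ᵥ 0ᵥ → x ≈ 0# × y ≈ 0#
    eigenvector-injective {x} {y} x,y≈0 =
      trans (sym (trans (x+y*0≈x _ y) (*-identityʳ x))) (x,y≈0 (zero , false)) ,
      trans (sym (trans (x*0+y≈y x _) (*-identityʳ y))) (x,y≈0 (zero , true))

    eigenvector-scale : ∀ {x y a b} X → x ≈ X * a → y ≈ X * b → eigenvector x y ≈ᵥ (λ e → X * eigenvector a b e)
    eigenvector-scale {x} {y} {a} {b} X x≈Xa y≈Xb e = begin
      x * φ + y * ψ             ≈⟨ +-cong (*-congʳ x≈Xa) (*-congʳ y≈Xb) ⟩
      X * a * φ + X * b * ψ     ≈⟨ +-cong (*-assoc X a φ) (*-assoc X b ψ) ⟩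
      X * (a * φ) + X * (b * ψ) ≈⟨ distribˡ X _ _ ⟨
      X * (a * φ + b * ψ)       ∎
      where
      φ = forwardEigenvector e
      ψ = backwardEigenvector e

    dim-V : HasDim V 2
    dim-V = basis , basis-∈V , independent , spanning
      where
      basis : Fin 2 → Vect
      basis = forwardEigenvector ∷ backwardEigenvector ∷ []
      lincomb≈eigenvector : ∀ a → lincomb a basis ≈ᵥ eigenvector (a zero) (a (suc zero))
      lincomb≈eigenvector a e = +-congˡ (+-identityʳ _)
      basis-∈V : ∀ i → V (basis i)
      basis-∈V zero       = lift (geometric⇒eigenvector (powers-geometric μʳ≈1) zero-geometric)
      basis-∈V (suc zero) = lift (geometric⇒eigenvector zero-geometric (powers-geometric λʳ≈1))
      independent : ∀ a → lincomb a basis ≈ᵥ 0ᵥ → ∀ i → a i ≈ 0#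
      independent a a≈0 zero       = proj₁ (eigenvector-injective (λ e → trans (sym (lincomb≈eigenvector a e)) (a≈0 e)))
      independent a a≈0 (suc zero) = proj₂ (eigenvector-injective (λ e → trans (sym (lincomb≈eigenvector a e)) (a≈0 e)))
      spanning : ∀ v → V v → Σ (Fin 2 → Carrier) λ a → v ≈ᵥ lincomb a basis
      spanning v (lift eig) = coordinates , λ e →
        trans (eigenvector-unique eig e) (sym (lincomb≈eigenvector coordinates e))
        where
        coordinates : Fin 2 → Carrier
        coordinates = v (zero , false) ∷ v (zero , true) ∷ []

    inflowWeight-into : ∀ {k v} e → tgt G e ≡ k → inflowWeight λ₀ k v e ≈ 1#
    inflowWeight-into {k} (i , false) e→k with next i ≟ k
    ... | yes _   = refl
    ... | no ¬e→k = ⊥-elim (¬e→k e→k)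
    inflowWeight-into {k} (i , true)  e→k with i ≟ k
    ... | yes _   = refl
    ... | no ¬e→k = ⊥-elim (¬e→k e→k)

    inflowWeight-other : ∀ {k v} e → tgt G e ≢ k → inflowWeight λ₀ k v e ≈ 0#
    inflowWeight-other {k} (i , false) ¬e→k with next i ≟ k
    ... | yes e→k = ⊥-elim (¬e→k e→k)
    ... | no _    = refl
    inflowWeight-other {k} (i , true)  ¬e→k with i ≟ k
    ... | yes e→k = ⊥-elim (¬e→k e→k)
    ... | no _    = refl

    inflow : ∀ k v → ∑ₒ (λ e → inflowWeight λ₀ k v e * v e) ≈ v (prev k , false) + v (k , true)
    inflow k v = begin
      ∑ₒ (λ e → ι e * v e)                            ≈⟨ ∑ₒ-split G (λ e → ι e * v e) ⟩
      ∑ (λ j → ι (j , false) * v (j , false)) + ∑ (λ j → ι (j , true) * v (j , true))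
        ≈⟨ +-cong (∑-single _ (prev k) forward-other) (∑-single _ k backward-other) ⟩
      ι (prev k , false) * v (prev k , false) + ι (k , true) * v (k , true)
        ≈⟨ +-cong (weight-one (prev k , false) (next-prev k)) (weight-one (k , true) ≡.refl) ⟩
      v (prev k , false) + v (k , true)               ∎
      where
      ι = inflowWeight λ₀ k v
      weight-one : ∀ e → tgt G e ≡ k → ι e * v e ≈ v e
      weight-one e e→k = trans (*-congʳ (inflowWeight-into {v = v} e e→k)) (*-identityˡ (v e))
      weight-zero : ∀ e → tgt G e ≢ k → ι e * v e ≈ 0#
      weight-zero e ¬e→k = trans (*-congʳ (inflowWeight-other {v = v} e ¬e→k)) (zeroˡ (v e))
      forward-other : ∀ j → j ≢ prev k → ι (j , false) * v (j , false) ≈ 0#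
      forward-other j j≢prev = weight-zero (j , false) (j≢prev ∘ next≡⇒≡prev)
      backward-other : ∀ j → j ≢ k → ι (j , true) * v (j , true) ≈ 0#
      backward-other j = weight-zero (j , true)

    Balanced : Fin (suc m) → Vect → Set ℓ
    Balanced k v = λ₀ * v (k , false) + v (k , true) ≈ 0#

    inflow-eigenvector : ∀ {v} k → IsEigenvector v →
                         ∑ₒ (λ e → inflowWeight λ₀ k v e * v e) ≈ λ₀ * v (k , false) + v (k , true)
    inflow-eigenvector {v} k eig = trans (inflow k v)
      (+-congʳ (trans (sym (Bmul-nbPredecessor v (k , false))) (eig (k , false))))

    W⇒balanced : ∀ {k v} → W k v → IsEigenvector v × Balanced k v
    W⇒balanced {k} (lift (eig , inflow≈0)) = eig , trans (sym (inflow-eigenvector k eig)) inflow≈0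

    balanced⇒W : ∀ {k v} → IsEigenvector v → Balanced k v → W k v
    balanced⇒W {k} eig balanced = lift (eig , trans (inflow-eigenvector k eig) balanced)

    balancedEigenvector : Fin (suc m) → Vect
    balancedEigenvector k = eigenvector (λ₀ ^ᶠ toℕ k) (- (λ₀ * μ ^ᶠ toℕ k))

    balancedEigenvector-at : ∀ k → balancedEigenvector k (k , false) ≈ 1#
    balancedEigenvector-at k = trans (x+y*0≈x _ _) (^ᶠ-inverse λμ≈1 (toℕ k))

    balancedEigenvector-balanced : ∀ k → Balanced k (balancedEigenvector k)
    balancedEigenvector-balanced k = begin
      λ₀ * balancedEigenvector k (k , false) + balancedEigenvector k (k , true)
        ≈⟨ +-cong (*-congˡ (x+y*0≈x _ _)) (x*0+y≈y _ _) ⟩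
      λ₀ * (λᵏ * μᵏ) + - (λ₀ * μᵏ) * λᵏ
        ≈⟨ +-congˡ (trans (sym (-‿distribˡ-* _ _)) (-‿cong (xy∙z≈x∙zy λ₀ μᵏ λᵏ))) ⟩
      λ₀ * (λᵏ * μᵏ) + - (λ₀ * (λᵏ * μᵏ))
        ≈⟨ -‿inverseʳ _ ⟩
      0# ∎
      where
      λᵏ = λ₀ ^ᶠ toℕ k
      μᵏ = μ ^ᶠ toℕ k

    eigenvector-forwardStart : ∀ {v} k → IsEigenvector v → v (zero , false) ≈ v (k , false) * λ₀ ^ᶠ toℕ k
    eigenvector-forwardStart {v} k eig = begin
      x               ≈⟨ *-identityˡ x ⟨
      1# * x          ≈⟨ *-congʳ (^ᶠ-inverse μλ≈1 (toℕ k)) ⟨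
      μᵏ * λᵏ * x     ≈⟨ xy∙z≈xz∙y μᵏ λᵏ x ⟩
      μᵏ * x * λᵏ     ≈⟨ *-congʳ (geometric-closedForm (proj₁ (eigenvector⇒geometric eig)) k) ⟨
      v (k , false) * λᵏ ∎
      where
      x = v (zero , false)
      λᵏ = λ₀ ^ᶠ toℕ k
      μᵏ = μ ^ᶠ toℕ k

    balanced-backwardStart : ∀ {v} k → IsEigenvector v → Balanced k v →
                             v (zero , true) ≈ v (k , false) * - (λ₀ * μ ^ᶠ toℕ k)
    balanced-backwardStart {v} k eig balanced = begin
      y                   ≈⟨ *-identityˡ y ⟨
      1# * y              ≈⟨ *-congʳ (^ᶠ-inverse λμ≈1 (toℕ k)) ⟨
      λᵏ * μᵏ * y         ≈⟨ xy∙z≈xz∙y λᵏ μᵏ y ⟩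
      λᵏ * y * μᵏ         ≈⟨ *-congʳ (geometric-closedForm (proj₂ (eigenvector⇒geometric eig)) k) ⟨
      v (k , true) * μᵏ   ≈⟨ *-congʳ (inverseʳ-unique _ _ balanced) ⟩
      - (λ₀ * X) * μᵏ     ≈⟨ -‿distribˡ-* _ _ ⟨
      - (λ₀ * X * μᵏ)     ≈⟨ -‿cong (xy∙z≈y∙xz λ₀ X μᵏ) ⟩
      - (X * (λ₀ * μᵏ))   ≈⟨ -‿distribʳ-* _ _ ⟩
      X * - (λ₀ * μᵏ)     ∎
      where
      y = v (zero , true)
      X = v (k , false)
      λᵏ = λ₀ ^ᶠ toℕ k
      μᵏ = μ ^ᶠ toℕ k

    balanced⇒multiple : ∀ {v} k → IsEigenvector v → Balanced k v →
                        v ≈ᵥ (λ e → v (k , false) * balancedEigenvector k e)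
    balanced⇒multiple k eig balanced e = trans (eigenvector-unique eig e)
      (eigenvector-scale _ (eigenvector-forwardStart k eig) (balanced-backwardStart k eig balanced) e)

    dim-W : ∀ k → HasDim (W k) 1
    dim-W k = (λ _ → w) , (λ _ → w-∈W) , independent , spanning
      where
      w = balancedEigenvector k
      w-∈W : W k w
      w-∈W = balanced⇒W (eigenvector-isEigenvector _ _) (balancedEigenvector-balanced k)
      independent : ∀ a → lincomb a (λ _ → w) ≈ᵥ 0ᵥ → ∀ i → a i ≈ 0#
      independent a a≈0 zero = begin
        a zero                          ≈⟨ *-identityʳ _ ⟨
        a zero * 1#                     ≈⟨ *-congˡ (balancedEigenvector-at k) ⟨
        a zero * w (k , false)          ≈⟨ +-identityʳ _ ⟨
        lincomb a (λ _ → w) (k , false) ≈⟨ a≈0 (k , false) ⟩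
        0#                              ∎
      spanning : ∀ v → W k v → Σ (Fin 1 → Carrier) λ a → v ≈ᵥ lincomb a (λ _ → w)
      spanning v v∈W = (λ _ → v (k , false)) , λ e →
        trans (balanced⇒multiple k eig balanced e) (sym (+-identityʳ _))
        where
        eig = proj₁ (W⇒balanced v∈W)
        balanced = proj₂ (W⇒balanced v∈W)

lemma5p6 : ∀ {c ℓ : Level} (F : Field c ℓ) (r : ℕ) → 1 ≤ r → (k : Fin r) (λ₀ : Field.Carrier F) →
    Field._≈_ F (LinAlg._^ᶠ_ F λ₀ r) (Field.1# F) →
    LinAlg.OnGraph.HasDim F (circleGraph r) (LinAlg.Circle.V F r λ₀) 2
      × LinAlg.OnGraph.HasDim F (circleGraph r) (LinAlg.Circle.W F r λ₀ k) 1
lemma5p6 F (suc m) _ k λ₀ λʳ≈1 = dim-V , dim-W k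
  where open CircleEigenvectors F m λ₀ λʳ≈1
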